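{- The subspace $\mathrm{span}_{\mathbb{Q}}\{\mathcal{I}^{\mathrm{adm}}\}$ spanned by admissible integer indices is a $\mathbb{Q}$-subalgebra of $(\mathrm{span}_{\mathbb{Q}}\{\mathcal{I}\},\ast)$.
   Context: An integer index is a tuple $\mathbf{k}=(k_1,\dots,k_r)\in\mathbb{Z}^r$, $r\ge0$ ($\emptyset$ for $r=0$); $\mathcal{I}=\bigsqcup_{r\ge0}\mathbb{Z}^r$ and $\mathrm{span}_{\mathbb{Q}}\{S\}$ is the formal $\mathbb{Q}$-vector space with basis $S$. For $r\ge1$, $m_{\mathbf{k}}=\min_{1\le t\le r}\sum_{i=t}^r(k_i-1)$, and $m_\emptyset=\infty$; $\mathbf{k}$ is admissible if $m_{\mathbf{k}}>0$, and $\mathcal{I}^{\mathrm{adm}}$ is the set of admissible indices. The stuffle product $\ast$ is the bilinear product on $\mathrm{span}_{\mathbb{Q}}\{\mathcal{I}\}$ defined recursively by $\emptyset\ast\mathbf{k}=\mathbf{k}\ast\emptyset=\mathbf{k}$ and, for $\mathbf{k},\mathbf{k}'\in\mathcal{I}$, $k,k'\in\mathbb{Z}$, $(\mathbf{k},k)\ast(\mathbf{k}',k')=(\mathbf{k}\ast(\mathbf{k}',k'),k)+((\mathbf{k},k)\ast\mathbf{k}',k')+(\mathbf{k}\ast\mathbf{k}',k+k')$, where $(\mathbf{k},k)$ denotes concatenation and $(\Sigma,a)$ means appending $a$ to every index of $\Sigma$, extended linearly. -}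

module Defs where

open import Data.Integer as ℤ using (ℤ; _+_; _-_; _<_; +_)
open import Data.Integer using () renaming (_⊓_ to minℤ)
open import Data.Rational as ℚ using (ℚ)
open import Data.List using (List; []; _∷_; map; _++_; reverse; concatMap)
open import Data.List.Properties using (≡-dec)
open import Data.List.Relation.Unary.All using (All)
open import Data.Maybe using (Maybe; just; nothing)
open import Data.Product using (_×_; _,_; proj₂; Σ; Σ-syntax)
open import Data.Unit using (⊤)
open import Relation.Binary.PropositionalEquality using (_≡_)
open import Relation.Nullary using (yes; no)

-- An integer index (k₁,…,k_r), stored in natural order; ∅ = [].
Index : Set
Index = List ℤ

tailSum : Index → ℤ
tailSum []       = + 0
tailSum (k ∷ ks) = (k - + 1) + tailSum ks

-- m_k = min_{1≤t≤r} Σ_{i=t}^{r} (k_i - 1);  nothing encodes m_∅ = ∞.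
m : Index → Maybe ℤ
m []       = nothing
m (k ∷ ks) with m ks
... | nothing = just (tailSum (k ∷ ks))
... | just v  = just (minℤ (tailSum (k ∷ ks)) v)

Admissible : Index → Set
Admissible k with m k
... | nothing = ⊤
... | just v  = + 0 < v

-- Elements of span_ℚ{𝓘}: finite formal ℚ-linear combinations,
-- represented by lists of (coefficient, index); equality is via coefficients.
FormalSum : Set
FormalSum = List (ℚ × Index)

coeff : FormalSum → Index → ℚ
coeff []              i = ℚ.0ℚ
coeff ((q , k) ∷ xs) i with ≡-dec ℤ._≟_ k i
... | yes _ = q ℚ.+ coeff xs i
... | no  _ = coeff xs i

_≈_ : FormalSum → FormalSum → Set
x ≈ y = ∀ i → coeff x i ≡ coeff y i

-- Stuffle on reversed indices (head = last entry k_r); this is the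
-- recursion (k,k)∗(k',k') = (k∗(k',k'),k) + ((k,k)∗k',k') + (k∗k',k+k')
-- read on reversed lists.  All coefficients are 1, so the result is a list.
revStuffle : Index → Index → List Index
revStuffle []       l        = l ∷ []
revStuffle (a ∷ k)  []       = (a ∷ k) ∷ []
revStuffle (a ∷ k)  (b ∷ l)  =
  map (a ∷_) (revStuffle k (b ∷ l)) ++
  map (b ∷_) (revStuffle (a ∷ k) l) ++
  map ((a + b) ∷_) (revStuffle k l)

stuffleIdx : Index → Index → List Index
stuffleIdx k l = map reverse (revStuffle (reverse k) (reverse l))

_∗_ : FormalSum → FormalSum → FormalSum
x ∗ y = concatMap (λ { (q , k) → concatMap (λ { (q' , l) →
          map (λ j → (q ℚ.* q' , j)) (stuffleIdx k l) }) y }) x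

_⊕_ : FormalSum → FormalSum → FormalSum
x ⊕ y = x ++ y

_·_ : ℚ → FormalSum → FormalSum
c · x = map (λ { (q , k) → (c ℚ.* q , k) }) x

one : FormalSum
one = (ℚ.1ℚ , []) ∷ []

InSpanAdm : FormalSum → Set
InSpanAdm x = Σ[ L ∈ FormalSum ] (All (λ p → Admissible (proj₂ p)) L × x ≈ L)

IsSubalgebra : (FormalSum → Set) → Set
IsSubalgebra A =
  A one ×
  (∀ x y → A x → A y → A (x ⊕ y)) ×
  (∀ c x → A x → A (c · x)) ×
  (∀ x y → A x → A y → A (x ∗ y))

{-# OPTIONS --safe #-}
module Submission where

-- Read from its last entry, an index is admissible iff every partial sum of the
-- kᵢ - 1 is positive.  The stuffle recursion builds each word from the back by
-- taking the last entry of k, that of l, or their sum.  If the consumed parts of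
-- k and l have partial sums s, t ≥ 0, the word built so far has partial sum at
-- least s + t (merging a and b into a + b even gains 1), so every word of k ∗ l
-- is admissible when k and l are.
--
-- For formal sums, each coefficient of x ∗ y is the value at x of a linear
-- functional depending linearly on y, and a linear functional takes equal values
-- on formal sums with equal coefficients.  Hence ∗ respects coefficientwise
-- equality, and x ∗ y equals the product of the admissible combinations
-- representing x and y.

open import Defs
open import Data.List using (List; []; _∷_; concatMap)
open import Data.List.Relation.Unary.All as All using (All; []; _∷_)
open import Data.List.Relation.Unary.All.Properties using (map⁺; ++⁺; concat⁺)
open import Data.Product using (_,_; proj₂)
open import Data.Unit using (tt)
open import Function using (_∘_)
open import Relation.Binary.PropositionalEquality using (refl)

module Admissibility where

  open import Data.Integer using (ℤ; 0ℤ; 1ℤ; _+_; _-_; _<_; _≤_; _⊓_; nonNegative)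
  open import Data.Integer.Properties
    using ( ≤-refl; ≤-trans; ≤-reflexive; <-≤-trans; <⇒≤; i<j⇒suc[i]≤j; suc[i]≤j⇒i<j; i⊓j≤i; i⊓j≤j; ⊓-glb
          ; +-assoc; +-monoʳ-≤; +-mono-<; +-mono-<-≤; +-mono-≤-<; i≤i+j; i≤j+i )
  open import Data.Integer.Tactic.RingSolver using (solve-∀)
  open import Data.List using (map; reverse; reverseAcc)
  open import Data.List.Properties using (reverse-involutive)
  open import Data.Maybe using (just; nothing)
  open import Data.Product using (_×_; proj₁)
  open import Data.Unit using (⊤)
  open import Function.Bundles using (_⇔_; mk⇔; Equivalence)
  open import Relation.Binary.PropositionalEquality using (_≡_; sym; subst)

  open Equivalence using (to; from)

  positive-⊓ : ∀ i j → 0ℤ < i ⊓ j ⇔ (0ℤ < i × 0ℤ < j)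
  positive-⊓ i j = mk⇔
    (λ p → suc[i]≤j⇒i<j (≤-trans (i<j⇒suc[i]≤j p) (i⊓j≤i i j)) ,
           suc[i]≤j⇒i<j (≤-trans (i<j⇒suc[i]≤j p) (i⊓j≤j i j)))
    (λ (p , q) → suc[i]≤j⇒i<j (⊓-glb (i<j⇒suc[i]≤j p) (i<j⇒suc[i]≤j q)))

  admissible-∷ : ∀ k ks → Admissible (k ∷ ks) ⇔ (0ℤ < tailSum (k ∷ ks) × Admissible ks)
  admissible-∷ k ks with m ks
  ... | nothing = mk⇔ (_, tt) proj₁
  ... | just v  = positive-⊓ _ v

  -- RevAdmissible c r: r lists an index from its last entry on, and every
  -- partial sum c + Σ (kᵢ - 1) over a nonempty initial segment of r is positive.
  RevAdmissible : ℤ → Index → Set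
  RevAdmissible c []      = ⊤
  RevAdmissible c (a ∷ r) = 0ℤ < (a - 1ℤ) + c × RevAdmissible ((a - 1ℤ) + c) r

  admissible-reverseAcc : ∀ acc r →
                          Admissible (reverseAcc acc r) ⇔ (Admissible acc × RevAdmissible (tailSum acc) r)
  admissible-reverseAcc acc []      = mk⇔ (_, tt) proj₁
  admissible-reverseAcc acc (a ∷ r) = mk⇔
    (λ h → let (ha , hr) = to ih h ; (p , hacc) = to (admissible-∷ a acc) ha in hacc , p , hr)
    (λ (hacc , p , hr) → from ih (from (admissible-∷ a acc) (p , hacc) , hr))
    where ih = admissible-reverseAcc (a ∷ acc) r

  admissible-reverse : ∀ r → Admissible (reverse r) ⇔ RevAdmissible 0ℤ r
  admissible-reverse r = mk⇔ (proj₂ ∘ to equiv) (λ h → from equiv (tt , h))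
    where equiv = admissible-reverseAcc [] r

  revAdmissible-mono : ∀ {c d} r → c ≤ d → RevAdmissible c r → RevAdmissible d r
  revAdmissible-mono []      c≤d _       = tt
  revAdmissible-mono (a ∷ r) c≤d (p , h) = <-≤-trans p c′≤d′ , revAdmissible-mono r c′≤d′ h
    where c′≤d′ = +-monoʳ-≤ (a - 1ℤ) c≤d

  revAdmissible-∷ : ∀ {c d} x {L} → 0ℤ < c → c ≤ (x - 1ℤ) + d →
                    All (RevAdmissible c) L → All (RevAdmissible d) (map (x ∷_) L)
  revAdmissible-∷ x 0<c c≤d hs = map⁺ (All.map (λ {r} h → <-≤-trans 0<c c≤d , revAdmissible-mono r c≤d h) hs)

  revStuffle-revAdmissible : ∀ {s t} u v → 0ℤ ≤ s → 0ℤ ≤ t → RevAdmissible s u → RevAdmissible t v →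
                             All (RevAdmissible (s + t)) (revStuffle u v)
  revStuffle-revAdmissible {s} {t} [] v 0≤s _ _ hv =
    revAdmissible-mono v (i≤j+i t s {{nonNegative 0≤s}}) hv ∷ []
  revStuffle-revAdmissible {s} {t} (a ∷ u) [] _ 0≤t hu _ =
    revAdmissible-mono (a ∷ u) (i≤i+j s t {{nonNegative 0≤t}}) hu ∷ []
  revStuffle-revAdmissible {s} {t} (a ∷ u) (b ∷ v) 0≤s 0≤t hau@(pa , hu) hbv@(pb , hv) =
    ++⁺ (revAdmissible-∷ a (+-mono-<-≤ pa 0≤t) (≤-reflexive (+-assoc (a - 1ℤ) s t))
          (revStuffle-revAdmissible u (b ∷ v) (<⇒≤ pa) 0≤t hu hbv))
    (++⁺ (revAdmissible-∷ b (+-mono-≤-< 0≤s pb) (≤-reflexive (pull-b s t b))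
          (revStuffle-revAdmissible (a ∷ u) v 0≤s (<⇒≤ pb) hau hv))
         (revAdmissible-∷ (a + b) (+-mono-< pa pb) (≤-trans (i≤i+j _ 1ℤ) (≤-reflexive (merge a b s t)))
          (revStuffle-revAdmissible u v (<⇒≤ pa) (<⇒≤ pb) hu hv)))
    where
    pull-b : ∀ s t b → s + ((b - 1ℤ) + t) ≡ (b - 1ℤ) + (s + t)
    pull-b = solve-∀
    merge : ∀ a b s t → ((a - 1ℤ) + s) + ((b - 1ℤ) + t) + 1ℤ ≡ ((a + b) - 1ℤ) + (s + t)
    merge = solve-∀

  stuffleIdx-admissible : ∀ k l → Admissible k → Admissible l → All Admissible (stuffleIdx k l)
  stuffleIdx-admissible k l hk hl =
    map⁺ (All.map (from (admissible-reverse _))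
      (revStuffle-revAdmissible (reverse k) (reverse l) ≤-refl ≤-refl
        (revAdmissible-reverse k hk) (revAdmissible-reverse l hl)))
    where
    revAdmissible-reverse : ∀ k → Admissible k → RevAdmissible 0ℤ (reverse k)
    revAdmissible-reverse k hk =
      to (admissible-reverse (reverse k)) (subst Admissible (sym (reverse-involutive k)) hk)

module FormalSumCoefficients where

  open import Algebra.Bundles using (CommutativeMonoid)
  open import Data.Integer as ℤ using ()
  open import Data.List using (_++_; map; foldr; filter; length)
  open import Data.List.Properties using (≡-dec; length-filter)
  open import Data.Nat as ℕ using (suc; s≤s)
  open import Data.Nat.Properties as ℕ using ()
  open import Data.Rational using (ℚ; 0ℚ; 1ℚ; _+_; _*_; -_; _-_)
  open import Data.Rational.Properties
    using ( +-identityˡ; +-identityʳ; +-assoc; +-inverseʳ; *-identityʳ; *-assoc; *-zeroˡ; *-zeroʳ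
          ; *-distribˡ-+; *-distribʳ-+; +-0-commutativeMonoid; +-0-group; +-*-ring )
  open import Algebra.Properties.CommutativeSemigroup (CommutativeMonoid.commutativeSemigroup +-0-commutativeMonoid)
    using (x∙yz≈y∙xz)
  open import Algebra.Properties.Group +-0-group using (x∙y⁻¹≈ε⇒x≈y)
  open import Algebra.Properties.Ring +-*-ring using (-1*x≈-x)
  open import Relation.Nullary using (yes; no; ¬?; contradiction)
  open import Relation.Binary.PropositionalEquality using (_≡_; _≗_; sym; trans; cong; cong₂; module ≡-Reasoning)

  open ≡-Reasoning

  eval : (Index → ℚ) → FormalSum → ℚ
  eval f []            = 0ℚ
  eval f ((q , k) ∷ x) = q * f k + eval f x

  δ : Index → Index → ℚ
  δ i k with ≡-dec ℤ._≟_ k i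
  ... | yes _ = 1ℚ
  ... | no  _ = 0ℚ

  coeff≡eval-δ : ∀ x i → coeff x i ≡ eval (δ i) x
  coeff≡eval-δ []            i = refl
  coeff≡eval-δ ((q , k) ∷ x) i with ≡-dec ℤ._≟_ k i
  ... | yes _ = cong₂ _+_ (sym (*-identityʳ q)) (coeff≡eval-δ x i)
  ... | no  _ =
    trans (coeff≡eval-δ x i) (sym (trans (cong (_+ eval (δ i) x) (*-zeroʳ q)) (+-identityˡ _)))

  eval-≗ : ∀ {f g} x → f ≗ g → eval f x ≡ eval g x
  eval-≗ []            f≗g = refl
  eval-≗ ((q , k) ∷ x) f≗g = cong₂ (λ a e → q * a + e) (f≗g k) (eval-≗ x f≗g)

  eval-++ : ∀ f x y → eval f (x ++ y) ≡ eval f x + eval f y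
  eval-++ f []            y = sym (+-identityˡ _)
  eval-++ f ((q , k) ∷ x) y =
    trans (cong (q * f k +_) (eval-++ f x y)) (sym (+-assoc (q * f k) (eval f x) (eval f y)))

  *-factorˡ : ∀ c q a e → (c * q) * a + c * e ≡ c * (q * a + e)
  *-factorˡ c q a e = trans (cong (_+ c * e) (*-assoc c q a)) (sym (*-distribˡ-+ c (q * a) e))

  eval-· : ∀ f c x → eval f (c · x) ≡ c * eval f x
  eval-· f c []            = sym (*-zeroʳ c)
  eval-· f c ((q , k) ∷ x) =
    trans (cong ((c * q) * f k +_) (eval-· f c x)) (*-factorˡ c q (f k) (eval f x))

  coeff-⊕ : ∀ x y i → coeff (x ⊕ y) i ≡ coeff x i + coeff y i
  coeff-⊕ x y i = begin
    coeff (x ⊕ y) i                 ≡⟨ coeff≡eval-δ (x ⊕ y) i ⟩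
    eval (δ i) (x ++ y)             ≡⟨ eval-++ (δ i) x y ⟩
    eval (δ i) x + eval (δ i) y     ≡⟨ sym (cong₂ _+_ (coeff≡eval-δ x i) (coeff≡eval-δ y i)) ⟩
    coeff x i + coeff y i           ∎

  coeff-· : ∀ c x i → coeff (c · x) i ≡ c * coeff x i
  coeff-· c x i = begin
    coeff (c · x) i                 ≡⟨ coeff≡eval-δ (c · x) i ⟩
    eval (δ i) (c · x)              ≡⟨ eval-· (δ i) c x ⟩
    c * eval (δ i) x                ≡⟨ cong (c *_) (sym (coeff≡eval-δ x i)) ⟩
    c * coeff x i                   ∎

  ⊕-cong : ∀ x x′ y y′ → x ≈ x′ → y ≈ y′ → (x ⊕ y) ≈ (x′ ⊕ y′)
  ⊕-cong x x′ y y′ x≈x′ y≈y′ i =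
    trans (coeff-⊕ x y i) (trans (cong₂ _+_ (x≈x′ i) (y≈y′ i)) (sym (coeff-⊕ x′ y′ i)))

  ·-cong : ∀ c x x′ → x ≈ x′ → (c · x) ≈ (c · x′)
  ·-cong c x x′ x≈x′ i = trans (coeff-· c x i) (trans (cong (c *_) (x≈x′ i)) (sym (coeff-· c x′ i)))

  without : Index → FormalSum → FormalSum
  without k = filter (λ t → ¬? (≡-dec ℤ._≟_ (proj₂ t) k))

  eval-without : ∀ f k x → eval f x ≡ coeff x k * f k + eval f (without k x)
  eval-without f k [] = sym (trans (+-identityʳ _) (*-zeroˡ (f k)))
  eval-without f k ((q , j) ∷ x) with ≡-dec ℤ._≟_ j k
  ... | yes refl = begin
    q * f j + eval f x              ≡⟨ cong (q * f j +_) (eval-without f j x) ⟩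
    q * f j + (c * f j + e)         ≡⟨ sym (+-assoc (q * f j) (c * f j) e) ⟩
    (q * f j + c * f j) + e         ≡⟨ cong (_+ e) (sym (*-distribʳ-+ (f j) q c)) ⟩
    (q + c) * f j + e               ∎
    where c = coeff x j ; e = eval f (without j x)
  ... | no _ =
    trans (cong (q * f j +_) (eval-without f k x)) (x∙yz≈y∙xz (q * f j) (coeff x k * f k) (eval f (without k x)))

  without-≈-[] : ∀ k x → x ≈ [] → without k x ≈ []
  without-≈-[] k x x≈0 i = begin
    coeff (without k x) i                             ≡⟨ coeff≡eval-δ (without k x) i ⟩
    eval (δ i) (without k x)                          ≡⟨ sym (+-identityˡ _) ⟩
    0ℚ + eval (δ i) (without k x)                     ≡⟨ cong (_+ eval (δ i) (without k x)) (sym (*-zeroˡ (δ i k))) ⟩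
    0ℚ * δ i k + eval (δ i) (without k x)             ≡⟨ cong (λ c → c * δ i k + eval (δ i) (without k x)) (sym (x≈0 k)) ⟩
    coeff x k * δ i k + eval (δ i) (without k x)      ≡⟨ sym (eval-without (δ i) k x) ⟩
    eval (δ i) x                                      ≡⟨ sym (coeff≡eval-δ x i) ⟩
    coeff x i                                         ≡⟨ x≈0 i ⟩
    0ℚ                                                ∎

  length-without-∷ : ∀ q k x → length (without k ((q , k) ∷ x)) ℕ.≤ length x
  length-without-∷ q k x with ≡-dec ℤ._≟_ k k
  ... | yes _   = length-filter _ x
  ... | no k≢k  = contradiction refl k≢k

  -- Deleting every term with the leading index keeps all coefficients zero and shortens the sum.
  eval-≈-[] : ∀ f x → x ≈ [] → eval f x ≡ 0ℚ
  eval-≈-[] f x = go (length x) x ℕ.≤-refl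
    where
    go : ∀ n x → length x ℕ.≤ n → x ≈ [] → eval f x ≡ 0ℚ
    go _ [] _ _ = refl
    go (suc n) x@((q , k) ∷ x′) (s≤s |x′|≤n) x≈0 = begin
      eval f x                                ≡⟨ eval-without f k x ⟩
      coeff x k * f k + eval f (without k x)  ≡⟨ cong₂ (λ c e → c * f k + e) (x≈0 k) without-k-vanishes ⟩
      0ℚ * f k + 0ℚ                           ≡⟨ trans (+-identityʳ (0ℚ * f k)) (*-zeroˡ (f k)) ⟩
      0ℚ                                      ∎
      where
      without-k-vanishes : eval f (without k x) ≡ 0ℚ
      without-k-vanishes =
        go n (without k x) (ℕ.≤-trans (length-without-∷ q k x′) |x′|≤n) (without-≈-[] k x x≈0)

  eval-difference : ∀ f x y → eval f (x ⊕ ((- 1ℚ) · y)) ≡ eval f x - eval f y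
  eval-difference f x y =
    trans (eval-++ f x ((- 1ℚ) · y)) (cong (eval f x +_) (trans (eval-· f (- 1ℚ) y) (-1*x≈-x (eval f y))))

  eval-cong : ∀ f x y → x ≈ y → eval f x ≡ eval f y
  eval-cong f x y x≈y =
    x∙y⁻¹≈ε⇒x≈y (eval f x) (eval f y) (trans (sym (eval-difference f x y)) (eval-≈-[] f d d≈0))
    where
    d = x ⊕ ((- 1ℚ) · y)
    d≈0 : d ≈ []
    d≈0 i = begin
      coeff d i                           ≡⟨ coeff≡eval-δ d i ⟩
      eval (δ i) d                        ≡⟨ eval-difference (δ i) x y ⟩
      eval (δ i) x - eval (δ i) y         ≡⟨ cong (_- eval (δ i) y) (sym (coeff≡eval-δ x i)) ⟩
      coeff x i - eval (δ i) y            ≡⟨ cong (_- eval (δ i) y) (trans (x≈y i) (coeff≡eval-δ y i)) ⟩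
      eval (δ i) y - eval (δ i) y         ≡⟨ +-inverseʳ (eval (δ i) y) ⟩
      0ℚ                                  ∎

  sumOver : (Index → ℚ) → List Index → ℚ
  sumOver f = foldr (λ j s → f j + s) 0ℚ

  eval-uniform : ∀ f c js → eval f (map (λ j → (c , j)) js) ≡ c * sumOver f js
  eval-uniform f c []       = sym (*-zeroʳ c)
  eval-uniform f c (j ∷ js) =
    trans (cong (c * f j +_) (eval-uniform f c js)) (sym (*-distribˡ-+ c (f j) (sumOver f js)))

  -- ((q , k) ∷ x) ∗ y reduces to stuffleRow q k y ++ x ∗ y.
  stuffleRow : ℚ → Index → FormalSum → FormalSum
  stuffleRow q k = concatMap λ { (q′ , l) → map (λ j → (q * q′ , j)) (stuffleIdx k l) }

  eval-stuffleRow : ∀ f q k y → eval f (stuffleRow q k y) ≡ q * eval (λ l → sumOver f (stuffleIdx k l)) y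
  eval-stuffleRow f q k []             = sym (*-zeroʳ q)
  eval-stuffleRow f q k ((q′ , l) ∷ y) =
    trans (eval-++ f (map (λ j → (q * q′ , j)) (stuffleIdx k l)) (stuffleRow q k y))
          (trans (cong₂ _+_ (eval-uniform f (q * q′) (stuffleIdx k l)) (eval-stuffleRow f q k y))
                 (*-factorˡ q q′ (sumOver f (stuffleIdx k l)) (eval (λ l → sumOver f (stuffleIdx k l)) y)))

  eval-∗ : ∀ f x y → eval f (x ∗ y) ≡ eval (λ k → eval (λ l → sumOver f (stuffleIdx k l)) y) x
  eval-∗ f []            y = refl
  eval-∗ f ((q , k) ∷ x) y =
    trans (eval-++ f (stuffleRow q k y) (x ∗ y)) (cong₂ _+_ (eval-stuffleRow f q k y) (eval-∗ f x y))

  ∗-cong : ∀ x x′ y y′ → x ≈ x′ → y ≈ y′ → (x ∗ y) ≈ (x′ ∗ y′)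
  ∗-cong x x′ y y′ x≈x′ y≈y′ i = begin
    coeff (x ∗ y) i                 ≡⟨ coeff≡eval-δ (x ∗ y) i ⟩
    eval (δ i) (x ∗ y)              ≡⟨ eval-∗ (δ i) x y ⟩
    eval (λ k → eval (w k) y) x     ≡⟨ eval-cong (λ k → eval (w k) y) x x′ x≈x′ ⟩
    eval (λ k → eval (w k) y) x′    ≡⟨ eval-≗ x′ (λ k → eval-cong (w k) y y′ y≈y′) ⟩
    eval (λ k → eval (w k) y′) x′   ≡⟨ sym (eval-∗ (δ i) x′ y′) ⟩
    eval (δ i) (x′ ∗ y′)            ≡⟨ sym (coeff≡eval-δ (x′ ∗ y′) i) ⟩
    coeff (x′ ∗ y′) i               ∎
    where
    w : Index → Index → ℚ
    w k l = sumOver (δ i) (stuffleIdx k l)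

open Admissibility using (stuffleIdx-admissible)
open FormalSumCoefficients using (⊕-cong; ·-cong; ∗-cong)

AdmissibleTerms : FormalSum → Set
AdmissibleTerms = All (Admissible ∘ proj₂)

concatMap⁺ : ∀ {A B : Set} {P : B → Set} {Q : A → Set} {f : A → List B} →
             (∀ {a} → Q a → All P (f a)) → ∀ {xs} → All Q xs → All P (concatMap f xs)
concatMap⁺ h = concat⁺ ∘ map⁺ ∘ All.map h

·-admissibleTerms : ∀ c {x} → AdmissibleTerms x → AdmissibleTerms (c · x)
·-admissibleTerms c = map⁺

∗-admissibleTerms : ∀ {x y} → AdmissibleTerms x → AdmissibleTerms y → AdmissibleTerms (x ∗ y)
∗-admissibleTerms hx hy =
  concatMap⁺ (λ {(_ , k)} hk → concatMap⁺ (λ {(_ , l)} hl → map⁺ (stuffleIdx-admissible k l hk hl)) hy) hx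

inSpanAdm-one : InSpanAdm one
inSpanAdm-one = one , tt ∷ [] , λ _ → refl

inSpanAdm-⊕ : ∀ x y → InSpanAdm x → InSpanAdm y → InSpanAdm (x ⊕ y)
inSpanAdm-⊕ x y (x′ , hx′ , x≈x′) (y′ , hy′ , y≈y′) =
  x′ ⊕ y′ , ++⁺ hx′ hy′ , ⊕-cong x x′ y y′ x≈x′ y≈y′

inSpanAdm-· : ∀ c x → InSpanAdm x → InSpanAdm (c · x)
inSpanAdm-· c x (x′ , hx′ , x≈x′) =
  c · x′ , ·-admissibleTerms c hx′ , ·-cong c x x′ x≈x′

inSpanAdm-∗ : ∀ x y → InSpanAdm x → InSpanAdm y → InSpanAdm (x ∗ y)
inSpanAdm-∗ x y (x′ , hx′ , x≈x′) (y′ , hy′ , y≈y′) =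
  x′ ∗ y′ , ∗-admissibleTerms hx′ hy′ , ∗-cong x x′ y y′ x≈x′ y≈y′

corollary5p4 : IsSubalgebra InSpanAdm
corollary5p4 = inSpanAdm-one , inSpanAdm-⊕ , inSpanAdm-· , inSpanAdm-∗
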